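{- For every $2$-tree $G$ and every vertex $v\in V(G)$, $G$ has a $1$-perfect orientation in which $v$ is a sink (in particular, $G$ is $1$-perfectly orientable). Every hollowed $2$-tree is $1$-perfectly orientable, but every $1$-perfect orientation of a hollowed $2$-tree has no sink.
   Context: All graphs are finite and simple. An orientation $D$ of a graph $G$ is $1$-perfect if for every vertex $u$, the out-neighborhood of $u$ in $D$ is a clique in $G$; $G$ is $1$-perfectly orientable if it has a $1$-perfect orientation. A sink is a vertex of out-degree $0$. A $2$-tree is defined recursively: $K_2$ is a $2$-tree, and a graph obtained from a $2$-tree by adding a new vertex adjacent to exactly two adjacent vertices is a $2$-tree; there are no others. A hollowed $2$-tree is defined recursively: every cycle of length at least four is a hollowed $2$-tree, and a graph obtained from a hollowed $2$-tree by adding a new vertex adjacent to exactly two adjacent vertices is a hollowed $2$-tree; there are no others. -}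

module Defs where

open import Data.Nat using (ℕ; zero; suc; _≡ᵇ_; _≥_)
open import Data.Fin using (Fin; zero; suc; toℕ; _≟_)
open import Data.Bool using (Bool; true; false; _∨_; _∧_; not)
open import Data.Product using (Σ; _×_; _,_)
open import Data.Sum using (_⊎_)
open import Function.Bundles using (_↔_; Inverse)
open import Relation.Nullary using (¬_)
open import Relation.Nullary.Decidable using (⌊_⌋)
open import Relation.Binary.PropositionalEquality using (_≡_; _≢_)

-- Simplicity (symmetry, irreflexivity) is not imposed here;
-- every graph produced by the inductive classes below is simple.
record Graph : Set where
  constructor mkGraph
  field
    n   : ℕ
    adj : Fin n → Fin n → Bool

open Graph public

Adj : (G : Graph) → Fin (n G) → Fin (n G) → Set
Adj G u v = adj G u v ≡ true

record _≅_ (G H : Graph) : Set where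
  field
    bij      : Fin (n G) ↔ Fin (n H)
    preserve : ∀ a b → adj H (Inverse.to bij a) (Inverse.to bij b) ≡ adj G a b

K₂ : Graph
K₂ = mkGraph 2 (λ a b → not ⌊ a ≟ b ⌋)

cycleAdj : (k : ℕ) → Fin k → Fin k → Bool
cycleAdj k a b =
  (suc (toℕ a) ≡ᵇ toℕ b) ∨ (suc (toℕ b) ≡ᵇ toℕ a)
  ∨ ((toℕ a ≡ᵇ 0) ∧ (suc (toℕ b) ≡ᵇ k))
  ∨ ((toℕ b ≡ᵇ 0) ∧ (suc (toℕ a) ≡ᵇ k))

Cycle : ℕ → Graph
Cycle k = mkGraph k (cycleAdj k)

-- Add a new vertex (labelled zero, old vertices shifted by suc)
-- adjacent exactly to u and v.
extendAdj : (G : Graph) → Fin (n G) → Fin (n G) → Fin (suc (n G)) → Fin (suc (n G)) → Bool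
extendAdj G u v zero    zero    = false
extendAdj G u v zero    (suc b) = ⌊ b ≟ u ⌋ ∨ ⌊ b ≟ v ⌋
extendAdj G u v (suc a) zero    = ⌊ a ≟ u ⌋ ∨ ⌊ a ≟ v ⌋
extendAdj G u v (suc a) (suc b) = adj G a b

extend : (G : Graph) → Fin (n G) → Fin (n G) → Graph
extend G u v = mkGraph (suc (n G)) (extendAdj G u v)

-- 2-trees (closed under isomorphism, as graph classes are).
data IsTwoTree : Graph → Set where
  base : IsTwoTree K₂
  step : ∀ {G} → IsTwoTree G → (u v : Fin (n G)) → Adj G u v → IsTwoTree (extend G u v)
  iso  : ∀ {G H} → IsTwoTree G → G ≅ H → IsTwoTree H

data IsHollowedTwoTree : Graph → Set where
  base : ∀ k → k ≥ 4 → IsHollowedTwoTree (Cycle k)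
  step : ∀ {G} → IsHollowedTwoTree G → (u v : Fin (n G)) → Adj G u v
       → IsHollowedTwoTree (extend G u v)
  iso  : ∀ {G H} → IsHollowedTwoTree G → G ≅ H → IsHollowedTwoTree H

record Orientation (G : Graph) : Set where
  field
    arc      : Fin (n G) → Fin (n G) → Bool
    arc-edge : ∀ u v → arc u v ≡ true → Adj G u v
    edge-dir : ∀ u v → Adj G u v →
               (arc u v ≡ true × arc v u ≡ false) ⊎ (arc u v ≡ false × arc v u ≡ true)

open Orientation public

Arc : {G : Graph} → Orientation G → Fin (n G) → Fin (n G) → Set
Arc D u v = arc D u v ≡ true

IsOnePerfect : (G : Graph) → Orientation G → Set
IsOnePerfect G D = ∀ u v w → Arc D u v → Arc D u w → v ≢ w → Adj G v w

OnePerfectlyOrientable : Graph → Set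
OnePerfectlyOrientable G = Σ (Orientation G) (IsOnePerfect G)

IsSink : {G : Graph} → Orientation G → Fin (n G) → Set
IsSink D v = ∀ w → ¬ Arc D v w

-- A 2-tree satisfies a stronger, inductive statement: for every edge ab there is a
-- 1-perfect orientation in which a is a sink and every arc leaving b ends in a.  When a
-- vertex z is attached to an edge uv, an old edge keeps its orientation and z becomes a
-- source (its out-neighbourhood {u, v} is a clique); an edge at z is handled by applying
-- the statement to uv with the endpoints chosen so that z, or its neighbour, is the sink.
--
-- A hollowed 2-tree is 1-perfectly orientable: orient the starting cycle cyclically and
-- every added vertex as a source.  It has no sink: in a cycle of length at least four the
-- two neighbours of a vertex are non-adjacent, so out-degrees are at most one and an arc
-- into a sink propagates all the way around the cycle back out of it.  An old sink of an
-- extension restricts to a sink, and if the new vertex were a sink, the head of the arc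
-- between its two neighbours would be a sink of the smaller graph.

module Submission where

open import Defs
open import Data.Bool using (Bool; true; false; not; _∨_; _∧_; T)
open import Data.Bool.Properties using (T-≡; T-not-≡; ∨-assoc; ∨-comm)
open import Data.Fin using (Fin; zero; suc; toℕ; _≟_)
open import Data.Fin.Properties using (toℕ-fromℕ<; toℕ-injective; toℕ<n; suc-injective)
open import Data.Nat using (ℕ; zero; suc; pred; _+_; _*_; _<_; _≤_; _≡ᵇ_; NonZero; >-nonZero; z≤n; s≤s)
open import Data.Nat.DivMod using (_%_; _/_; _mod_; m≡m%n+[m/n]*n; m%n%n≡m%n; %-distribˡ-+; [m+n]%n≡m%n; m<n⇒m%n≡m; n%n≡0)
open import Data.Nat.Divisibility using (divides; >⇒∤)
open import Data.Nat.Properties using (≡ᵇ⇒≡; ≡⇒≡ᵇ; +-identityʳ; +-suc; +-cancelˡ-≡; m≤n⇒m<n∨m≡n; suc-pred; ≤-trans; n≤1+n)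
open import Data.Product using (Σ; ∃; _×_; _,_; proj₁; proj₂)
import Data.Product as Product
open import Data.Sum using (_⊎_; inj₁; inj₂; swap)
import Data.Sum as Sum
open import Function using (id; _∘_)
open import Function.Bundles using (Inverse; Injection; Equivalence)
open import Function.Properties.Inverse using (↔⇒↣; ↔-sym)
open import Relation.Binary.PropositionalEquality
open import Relation.Nullary using (¬_; contradiction)
open import Relation.Nullary.Decidable using (⌊_⌋; toWitness; fromWitness; fromWitnessFalse)

≡true⇒T : ∀ {x} → x ≡ true → T x
≡true⇒T = Equivalence.from T-≡

T⇒≡true : ∀ {x} → T x → x ≡ true
T⇒≡true = Equivalence.to T-≡

∧-≡-true : ∀ {x y} → x ∧ y ≡ true → x ≡ true × y ≡ true
∧-≡-true {true} e = refl , e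

∨-≡-true : ∀ {x y} → x ∨ y ≡ true → x ≡ true ⊎ y ≡ true
∨-≡-true {true}  _ = inj₁ refl
∨-≡-true {false} e = inj₂ e

∨-≡-true⁻ : ∀ {x y} → x ≡ true ⊎ y ≡ true → x ∨ y ≡ true
∨-≡-true⁻ (inj₁ refl) = refl
∨-≡-true⁻ {true}  (inj₂ _) = refl
∨-≡-true⁻ {false} (inj₂ e) = e

∧-≡-true⁻ : ∀ {x y} → x ≡ true → y ≡ true → x ∧ y ≡ true
∧-≡-true⁻ refl e = e

≡ᵇ-true⇒≡ : ∀ {m n} → (m ≡ᵇ n) ≡ true → m ≡ n
≡ᵇ-true⇒≡ {m} {n} e = ≡ᵇ⇒≡ m n (≡true⇒T e)

≡⇒≡ᵇ-true : ∀ {m n} → m ≡ n → (m ≡ᵇ n) ≡ true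
≡⇒≡ᵇ-true {m} {n} e = T⇒≡true (≡⇒≡ᵇ m n e)

⌊≟⌋⇒≡ : ∀ {k} {a b : Fin k} → ⌊ a ≟ b ⌋ ≡ true → a ≡ b
⌊≟⌋⇒≡ e = toWitness (≡true⇒T e)

≡⇒⌊≟⌋ : ∀ {k} {a b : Fin k} → a ≡ b → ⌊ a ≟ b ⌋ ≡ true
≡⇒⌊≟⌋ e = T⇒≡true (fromWitness e)

≢⇒⌊≟⌋ : ∀ {k} {a b : Fin k} → a ≢ b → ⌊ a ≟ b ⌋ ≡ false
≢⇒⌊≟⌋ a≢b = Equivalence.to T-not-≡ (fromWitnessFalse a≢b)

module _ {G : Graph} (D : Orientation G) where

  arc-antisym : ∀ {x y} → Arc D x y → ¬ Arc D y x
  arc-antisym {x} {y} xy yx with edge-dir D x y (arc-edge D x y xy)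
  ... | inj₁ (_ , yx≡false) = contradiction (trans (sym yx) yx≡false) λ ()
  ... | inj₂ (xy≡false , _) = contradiction (trans (sym xy) xy≡false) λ ()

  reverseArc : ∀ {x y} → Adj G x y → ¬ Arc D x y → Arc D y x
  reverseArc {x} {y} e ¬xy with edge-dir D x y e
  ... | inj₁ (xy , _) = contradiction xy ¬xy
  ... | inj₂ (_ , yx) = yx

  adj⇒≢ : ∀ {x y} → Adj G x y → x ≢ y
  adj⇒≢ {x} e refl with edge-dir D x x e
  ... | inj₁ (xx , _) = arc-antisym xx xx
  ... | inj₂ (_ , xx) = arc-antisym xx xx

  arc⇒≢ : ∀ {x y} → Arc D x y → x ≢ y
  arc⇒≢ {x} {y} xy = adj⇒≢ (arc-edge D x y xy)

IsSymmetric : Graph → Set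
IsSymmetric G = ∀ x y → Adj G x y → Adj G y x

record _↪_ (H G : Graph) : Set where
  field
    embed     : Fin (n H) → Fin (n G)
    embed-inj : ∀ {x y} → embed x ≡ embed y → x ≡ y
    embed-adj : ∀ x y → adj G (embed x) (embed y) ≡ adj H x y

  embed-Adj : ∀ {x y} → Adj H x y → Adj G (embed x) (embed y)
  embed-Adj {x} {y} e = trans (embed-adj x y) e

  embed-Adj⁻ : ∀ {x y} → Adj G (embed x) (embed y) → Adj H x y
  embed-Adj⁻ {x} {y} e = trans (sym (embed-adj x y)) e

open _↪_

module _ {G H : Graph} (I : G ≅ H) where
  open _≅_ I

  ≅⇒↪ : G ↪ H
  ≅⇒↪ = record
    { embed     = Inverse.to bij
    ; embed-inj = Injection.injective (↔⇒↣ bij)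
    ; embed-adj = preserve
    }

  ≅⇒↪⁻ : H ↪ G
  ≅⇒↪⁻ = record
    { embed     = Inverse.from bij
    ; embed-inj = Injection.injective (↔⇒↣ (↔-sym bij))
    ; embed-adj = λ x y → trans (sym (preserve _ _))
                    (cong₂ (adj H) (Inverse.strictlyInverseˡ bij x) (Inverse.strictlyInverseˡ bij y))
    }

↪-symmetric : ∀ {G H} → H ↪ G → IsSymmetric G → IsSymmetric H
↪-symmetric ι sym-G x y e = embed-Adj⁻ ι (sym-G _ _ (embed-Adj ι e))

module _ {G H : Graph} (ι : H ↪ G) where

  pullback : Orientation G → Orientation H
  pullback D = record
    { arc      = λ x y → arc D (embed ι x) (embed ι y)
    ; arc-edge = λ x y xy → embed-Adj⁻ ι (arc-edge D _ _ xy)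
    ; edge-dir = λ x y e → edge-dir D _ _ (embed-Adj ι e)
    }

  pullback-onePerfect : ∀ D → IsOnePerfect G D → IsOnePerfect H (pullback D)
  pullback-onePerfect D P x y z xy xz y≢z = embed-Adj⁻ ι (P _ _ _ xy xz (y≢z ∘ embed-inj ι))

  pullback-sink : ∀ D t → IsSink D (embed ι t) → IsSink (pullback D) t
  pullback-sink D t sink w = sink (embed ι w)

extend-↪ : ∀ {G} u v → G ↪ extend G u v
extend-↪ u v = record { embed = suc ; embed-inj = suc-injective ; embed-adj = λ _ _ → refl }

extend-symmetric : ∀ {G} u v → IsSymmetric G → IsSymmetric (extend G u v)
extend-symmetric u v sym-G zero    zero    ()
extend-symmetric u v sym-G zero    (suc _) e = e
extend-symmetric u v sym-G (suc _) zero    e = e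
extend-symmetric u v sym-G (suc x) (suc y) e = sym-G x y e

K₂-adj⇒≢ : ∀ {a b} → Adj K₂ a b → a ≢ b
K₂-adj⇒≢ e refl = contradiction (trans (sym e) (cong not (≡⇒⌊≟⌋ refl))) λ ()

K₂-≢⇒adj : ∀ {a b} → a ≢ b → Adj K₂ a b
K₂-≢⇒adj a≢b = cong not (≢⇒⌊≟⌋ a≢b)

K₂-symmetric : IsSymmetric K₂
K₂-symmetric _ _ e = K₂-≢⇒adj (K₂-adj⇒≢ e ∘ sym)

towards : Fin 2 → Orientation K₂
towards a = record
  { arc      = λ x y → not ⌊ x ≟ a ⌋ ∧ ⌊ y ≟ a ⌋
  ; arc-edge = edge a
  ; edge-dir = dir a
  }
  where
  edge : ∀ a x y → not ⌊ x ≟ a ⌋ ∧ ⌊ y ≟ a ⌋ ≡ true → Adj K₂ x y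
  edge zero       zero       _          ()
  edge zero       (suc zero) zero       _  = refl
  edge zero       (suc zero) (suc zero) ()
  edge (suc zero) zero       zero       ()
  edge (suc zero) zero       (suc zero) _  = refl
  edge (suc zero) (suc zero) _          ()
  dir : ∀ a x y → Adj K₂ x y →
        (not ⌊ x ≟ a ⌋ ∧ ⌊ y ≟ a ⌋ ≡ true × not ⌊ y ≟ a ⌋ ∧ ⌊ x ≟ a ⌋ ≡ false)
        ⊎ (not ⌊ x ≟ a ⌋ ∧ ⌊ y ≟ a ⌋ ≡ false × not ⌊ y ≟ a ⌋ ∧ ⌊ x ≟ a ⌋ ≡ true)
  dir _          zero       zero       ()
  dir _          (suc zero) (suc zero) ()
  dir zero       zero       (suc zero) _ = inj₂ (refl , refl)
  dir zero       (suc zero) zero       _ = inj₁ (refl , refl)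
  dir (suc zero) zero       (suc zero) _ = inj₁ (refl , refl)
  dir (suc zero) (suc zero) zero       _ = inj₂ (refl , refl)

towards-head : ∀ {a x y} → Arc (towards a) x y → y ≡ a
towards-head xy = ⌊≟⌋⇒≡ (proj₂ (∧-≡-true xy))

towards-tail : ∀ {a x y} → Arc (towards a) x y → x ≢ a
towards-tail {a} {x} xy x≡a = contradiction (trans (sym (proj₁ (∧-≡-true xy))) (cong not (≡⇒⌊≟⌋ x≡a))) λ ()

-- The strengthening that makes induction on 2-trees work: to make a new vertex
-- adjacent to a and b a sink, both a and b must keep their out-neighbourhoods inside {a, b}.
record EdgeSinkOrientation (G : Graph) (a b : Fin (n G)) : Set where
  field
    orientation : Orientation G
    onePerfect  : IsOnePerfect G orientation
    sink        : IsSink orientation a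
    onlyToSink  : ∀ {w} → Arc orientation b w → w ≡ a

open EdgeSinkOrientation

↪-edgeSinkOrientation : ∀ {G H} (ι : H ↪ G) {a b} →
  EdgeSinkOrientation G (embed ι a) (embed ι b) → EdgeSinkOrientation H a b
↪-edgeSinkOrientation ι {a} S = record
  { orientation = pullback ι (orientation S)
  ; onePerfect  = pullback-onePerfect ι (orientation S) (onePerfect S)
  ; sink        = pullback-sink ι (orientation S) a (sink S)
  ; onlyToSink  = embed-inj ι ∘ onlyToSink S
  }

K₂-edgeSinkOrientation : ∀ {a b} → Adj K₂ a b → EdgeSinkOrientation K₂ a b
K₂-edgeSinkOrientation {a} {b} _ = record
  { orientation = towards a
  ; onePerfect  = λ x y z xy xz y≢z →
      contradiction (trans (towards-head {a} {x} xy) (sym (towards-head {a} {x} xz))) y≢z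
  ; sink        = λ w aw → towards-tail {a} {a} {w} aw refl
  ; onlyToSink  = towards-head {a} {b}
  }

-- Adding a vertex adjacent to both ends of an edge

module Extension (G : Graph) (u v : Fin (n G)) where

  G⁺ : Graph
  G⁺ = extend G u v

  Nbr : Fin (n G) → Set
  Nbr y = y ≡ u ⊎ y ≡ v

  adj-new⇒nbr : ∀ {y} → Adj G⁺ zero (suc y) → Nbr y
  adj-new⇒nbr e = Sum.map ⌊≟⌋⇒≡ ⌊≟⌋⇒≡ (∨-≡-true e)

  nbr⇒adj-new : ∀ {y} → Nbr y → Adj G⁺ zero (suc y)
  nbr⇒adj-new p = ∨-≡-true⁻ (Sum.map ≡⇒⌊≟⌋ ≡⇒⌊≟⌋ p)

  nbr-clique : IsSymmetric G → Adj G u v → ∀ {y y'} → Nbr y → Nbr y' → y ≢ y' → Adj G y y'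
  nbr-clique sym-G uv (inj₁ refl) (inj₁ refl) y≢y' = contradiction refl y≢y'
  nbr-clique sym-G uv (inj₁ refl) (inj₂ refl) _    = uv
  nbr-clique sym-G uv (inj₂ refl) (inj₁ refl) _    = sym-G u v uv
  nbr-clique sym-G uv (inj₂ refl) (inj₂ refl) y≢y' = contradiction refl y≢y'

  otherEndpoint : IsSymmetric G → Adj G u v → ∀ {y} → Nbr y →
    Σ (Fin (n G)) λ c → Adj G y c × (∀ {w} → Nbr w → w ≡ y ⊎ w ≡ c)
  otherEndpoint sym-G uv (inj₁ refl) = v , uv , id
  otherEndpoint sym-G uv (inj₂ refl) = u , sym-G u v uv , swap

  -- toNew y decides whether the edge between y and the new vertex points to the new vertex.
  extendOrientation : Orientation G → (Fin (n G) → Bool) → Orientation G⁺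
  extendOrientation D toNew = record { arc = arc⁺ ; arc-edge = edge⁺ ; edge-dir = dir⁺ }
    where
    arc⁺ : Fin (n G⁺) → Fin (n G⁺) → Bool
    arc⁺ zero    zero    = false
    arc⁺ zero    (suc y) = not (toNew y) ∧ adj G⁺ zero (suc y)
    arc⁺ (suc x) zero    = toNew x ∧ adj G⁺ zero (suc x)
    arc⁺ (suc x) (suc y) = arc D x y
    edge⁺ : ∀ x y → arc⁺ x y ≡ true → Adj G⁺ x y
    edge⁺ zero    zero    ()
    edge⁺ zero    (suc y) xy = proj₂ (∧-≡-true xy)
    edge⁺ (suc x) zero    xy = proj₂ (∧-≡-true xy)
    edge⁺ (suc x) (suc y) xy = arc-edge D x y xy
    dir⁺ : ∀ x y → Adj G⁺ x y →
           (arc⁺ x y ≡ true × arc⁺ y x ≡ false) ⊎ (arc⁺ x y ≡ false × arc⁺ y x ≡ true)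
    dir⁺ zero    zero    ()
    dir⁺ zero    (suc y) e with toNew y
    ... | false = inj₁ (e , refl)
    ... | true  = inj₂ (refl , e)
    dir⁺ (suc x) zero    e with toNew x
    ... | false = inj₂ (refl , e)
    ... | true  = inj₁ (e , refl)
    dir⁺ (suc x) (suc y) e = edge-dir D x y e

  module _ (D : Orientation G) (toNew : Fin (n G) → Bool) where

    private
      E : Orientation G⁺
      E = extendOrientation D toNew

    arc-to-new : ∀ x → Arc E (suc x) zero → toNew x ≡ true × Nbr x
    arc-to-new x xz with ∧-≡-true xz
    ... | t , e = t , adj-new⇒nbr e

    arc-from-new : ∀ y → Arc E zero (suc y) → toNew y ≡ false × Nbr y
    arc-from-new y zy with ∧-≡-true zy
    ... | t , e = Equivalence.to T-not-≡ (≡true⇒T t) , adj-new⇒nbr e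

    extend-onePerfect : IsOnePerfect G D
      → (∀ {x w} → Arc E (suc x) zero → Arc D x w → Nbr w)
      → (∀ {y y'} → Arc E zero (suc y) → Arc E zero (suc y') → y ≢ y' → Adj G y y')
      → IsOnePerfect G⁺ E
    extend-onePerfect P closed clique = perfect
      where
      perfect : IsOnePerfect G⁺ E
      perfect zero    zero    _       ()
      perfect zero    (suc _) zero    _  ()
      perfect zero    (suc y) (suc z) xy xz y≢z = clique xy xz (y≢z ∘ cong suc)
      perfect (suc _) zero    zero    _  _  y≢z = contradiction refl y≢z
      perfect (suc _) zero    (suc _) xy xz _   = nbr⇒adj-new (closed xy xz)
      perfect (suc _) (suc _) zero    xy xz _   = nbr⇒adj-new (closed xz xy)
      perfect (suc x) (suc y) (suc z) xy xz y≢z = P x y z xy xz (y≢z ∘ cong suc)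

    extend-sink : ∀ {a} → IsSink D a → toNew a ≡ false → IsSink E (suc a)
    extend-sink sink-a a-old zero    az = contradiction (trans (sym (proj₁ (arc-to-new _ az))) a-old) λ ()
    extend-sink sink-a a-old (suc w) aw = sink-a w aw

  extend-source-onePerfect : IsSymmetric G → Adj G u v → ∀ {D} → IsOnePerfect G D →
    IsOnePerfect G⁺ (extendOrientation D (λ _ → false))
  extend-source-onePerfect sym-G uv {D} P = extend-onePerfect D _ P
    (λ {x} xz _ → contradiction (proj₁ (arc-to-new D _ x xz)) λ ())
    (λ {y} {y'} zy zy' → nbr-clique sym-G uv (proj₂ (arc-from-new D _ y zy)) (proj₂ (arc-from-new D _ y' zy')))

  extend-oldEdge : IsSymmetric G → Adj G u v → ∀ {a b} →
    EdgeSinkOrientation G a b → EdgeSinkOrientation G⁺ (suc a) (suc b)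
  extend-oldEdge sym-G uv {a} {b} S = record
    { orientation = extendOrientation D (λ _ → false)
    ; onePerfect  = extend-source-onePerfect sym-G uv (onePerfect S)
    ; sink        = extend-sink D _ (sink S) refl
    ; onlyToSink  = onlyTo
    }
    where
    D = orientation S
    onlyTo : ∀ {w} → Arc (extendOrientation D (λ _ → false)) (suc b) w → w ≡ suc a
    onlyTo {zero}  bz = contradiction (proj₁ (arc-to-new D _ b bz)) λ ()
    onlyTo {suc w} bw = cong suc (onlyToSink S bw)

  extend-sinkAtNew : ∀ {b c} → Nbr b → (∀ {w} → Nbr w → w ≡ b ⊎ w ≡ c) →
    EdgeSinkOrientation G b c → EdgeSinkOrientation G⁺ zero (suc b)
  extend-sinkAtNew {b} {c} nbr-b cover S = record
    { orientation = E
    ; onePerfect  = extend-onePerfect D _ (onePerfect S) closed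
                      (λ {y} zy _ _ → contradiction (proj₁ (arc-from-new D _ y zy)) λ ())
    ; sink        = sink-new
    ; onlyToSink  = onlyTo
    }
    where
    D = orientation S
    E = extendOrientation D (λ _ → true)
    closed : ∀ {x w} → Arc E (suc x) zero → Arc D x w → Nbr w
    closed {x} xz xw with cover (proj₂ (arc-to-new D _ x xz))
    ... | inj₁ refl = contradiction xw (sink S _)
    ... | inj₂ refl = subst Nbr (sym (onlyToSink S xw)) nbr-b
    sink-new : IsSink E zero
    sink-new zero    ()
    sink-new (suc y) zy = contradiction (proj₁ (arc-from-new D _ y zy)) λ ()
    onlyTo : ∀ {w} → Arc E (suc b) w → w ≡ zero
    onlyTo {zero}  _  = refl
    onlyTo {suc w} bw = contradiction bw (sink S w)

  extend-sinkAtOld : ∀ {a c} → Nbr a → (∀ {w} → Nbr w → w ≡ a ⊎ w ≡ c) → a ≢ c →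
    EdgeSinkOrientation G a c → EdgeSinkOrientation G⁺ (suc a) zero
  extend-sinkAtOld {a} {c} nbr-a cover a≢c S = record
    { orientation = E
    ; onePerfect  = extend-onePerfect D _ (onePerfect S) closed
                      (λ zy zy' y≢y' → contradiction (trans (from-new zy) (sym (from-new zy'))) y≢y')
    ; sink        = extend-sink D _ (sink S) (≢⇒⌊≟⌋ a≢c)
    ; onlyToSink  = onlyTo
    }
    where
    D = orientation S
    toNew : Fin (n G) → Bool
    toNew y = ⌊ y ≟ c ⌋
    E = extendOrientation D toNew
    closed : ∀ {x w} → Arc E (suc x) zero → Arc D x w → Nbr w
    closed {x} xz xw with ⌊≟⌋⇒≡ (proj₁ (arc-to-new D toNew x xz))
    ... | refl = subst Nbr (sym (onlyToSink S xw)) nbr-a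
    from-new : ∀ {y} → Arc E zero (suc y) → y ≡ a
    from-new {y} zy with arc-from-new D toNew y zy
    ... | y-old , nbr-y with cover nbr-y
    ...   | inj₁ y≡a = y≡a
    ...   | inj₂ refl = contradiction (trans (sym (≡⇒⌊≟⌋ refl)) y-old) λ ()
    onlyTo : ∀ {w} → Arc E zero w → w ≡ suc a
    onlyTo {zero}  ()
    onlyTo {suc y} zy = cong suc (from-new zy)

  extend-edgeSinkOrientation : IsSymmetric G → Adj G u v →
    (∀ {a b} → Adj G a b → EdgeSinkOrientation G a b) →
    ∀ {a b} → Adj G⁺ a b → EdgeSinkOrientation G⁺ a b
  extend-edgeSinkOrientation sym-G uv old {zero}  {zero}  ()
  extend-edgeSinkOrientation sym-G uv old {suc a} {suc b} e = extend-oldEdge sym-G uv (old e)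
  extend-edgeSinkOrientation sym-G uv old {zero}  {suc b} e
    with otherEndpoint sym-G uv (adj-new⇒nbr e)
  ... | c , bc , cover = extend-sinkAtNew (adj-new⇒nbr e) cover (old bc)
  extend-edgeSinkOrientation sym-G uv old {suc a} {zero}  e
    with otherEndpoint sym-G uv (adj-new⇒nbr e)
  ... | c , ac , cover = extend-sinkAtOld (adj-new⇒nbr e) cover (adj⇒≢ (orientation (old ac)) ac) (old ac)

  restrict : Orientation G⁺ → Orientation G
  restrict = pullback (extend-↪ u v)

  module _ (D : Orientation G⁺) (P : IsOnePerfect G⁺ D) (sink-new : IsSink D zero) where

    -- The head s of the arc between u and v also points to the new vertex, so a
    -- further out-neighbour of s would have to be adjacent to the new vertex.
    restricted-headSink : ∀ {r s} → Nbr s → (∀ {w} → Nbr w → w ≡ s ⊎ w ≡ r) →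
      Arc D (suc r) (suc s) → IsSink (restrict D) s
    restricted-headSink {r} {s} nbr-s cover r→s w s→w
      with cover (adj-new⇒nbr {w} (P (suc s) zero (suc w) s→new s→w λ ()))
      where
      s→new : Arc D (suc s) zero
      s→new = reverseArc D (nbr⇒adj-new nbr-s) (sink-new (suc s))
    ... | inj₁ refl = arc⇒≢ D s→w refl
    ... | inj₂ refl = arc-antisym D r→s s→w

    newSink⇒restrictedSink : Adj G u v → ∃ (IsSink (restrict D))
    newSink⇒restrictedSink uv with edge-dir (restrict D) u v uv
    ... | inj₁ (u→v , _) = v , restricted-headSink (inj₂ refl) swap u→v
    ... | inj₂ (_ , v→u) = u , restricted-headSink (inj₁ refl) id v→u

-- 2-trees

twoTree-symmetric : ∀ {G} → IsTwoTree G → IsSymmetric G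
twoTree-symmetric base               = K₂-symmetric
twoTree-symmetric (step {G} T u v _) = extend-symmetric {G} u v (twoTree-symmetric T)
twoTree-symmetric (iso T I)          = ↪-symmetric (≅⇒↪⁻ I) (twoTree-symmetric T)

twoTree-edgeSinkOrientation : ∀ {G} → IsTwoTree G → ∀ {a b} → Adj G a b → EdgeSinkOrientation G a b
twoTree-edgeSinkOrientation base = K₂-edgeSinkOrientation
twoTree-edgeSinkOrientation (step {G} T u v uv) =
  Extension.extend-edgeSinkOrientation G u v (twoTree-symmetric T) uv (twoTree-edgeSinkOrientation T)
twoTree-edgeSinkOrientation (iso T I) e =
  ↪-edgeSinkOrientation (≅⇒↪⁻ I) (twoTree-edgeSinkOrientation T (embed-Adj (≅⇒↪⁻ I) e))

twoTree-neighbour : ∀ {G} → IsTwoTree G → ∀ t → ∃ (Adj G t)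
twoTree-neighbour base zero       = suc zero , refl
twoTree-neighbour base (suc zero) = zero , refl
twoTree-neighbour (step {G} T u v _) zero    = suc u , Extension.nbr⇒adj-new G u v (inj₁ refl)
twoTree-neighbour (step T u v _)     (suc t) = Product.map suc id (twoTree-neighbour T t)
twoTree-neighbour {H} (iso T I) t with twoTree-neighbour T (Inverse.from (_≅_.bij I) t)
... | b , e = embed (≅⇒↪ I) b ,
  subst (λ x → Adj H x (embed (≅⇒↪ I) b)) (Inverse.strictlyInverseˡ (_≅_.bij I) t) (embed-Adj (≅⇒↪ I) e)

twoTree-vertex : ∀ {G} → IsTwoTree G → Fin (n G)
twoTree-vertex base           = zero
twoTree-vertex (step _ _ _ _) = zero
twoTree-vertex (iso T I)      = embed (≅⇒↪ I) (twoTree-vertex T)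

twoTree-sinkOrientation : (G : Graph) → IsTwoTree G → (v : Fin (n G)) →
  Σ (Orientation G) (λ D → IsOnePerfect G D × IsSink D v)
twoTree-sinkOrientation G T v with twoTree-neighbour T v
... | _ , e = orientation S , onePerfect S , sink S
  where S = twoTree-edgeSinkOrientation T e

-- Cycles

∨-shuffle : ∀ x y z w → x ∨ (y ∨ (z ∨ w)) ≡ (x ∨ w) ∨ (y ∨ z)
∨-shuffle x y z w = begin
  x ∨ (y ∨ (z ∨ w))  ≡⟨ cong (x ∨_) (sym (∨-assoc y z w)) ⟩
  x ∨ ((y ∨ z) ∨ w)  ≡⟨ cong (x ∨_) (∨-comm (y ∨ z) w) ⟩
  x ∨ (w ∨ (y ∨ z))  ≡⟨ sym (∨-assoc x w (y ∨ z)) ⟩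
  (x ∨ w) ∨ (y ∨ z)  ∎
  where open ≡-Reasoning

[1+m%n]%n≡[1+m]%n : ∀ m n .{{_ : NonZero n}} → suc (m % n) % n ≡ suc m % n
[1+m%n]%n≡[1+m]%n m n = begin
  (1 + m % n) % n          ≡⟨ %-distribˡ-+ 1 (m % n) n ⟩
  (1 % n + m % n % n) % n  ≡⟨ cong (λ x → (1 % n + x) % n) (m%n%n≡m%n m n) ⟩
  (1 % n + m % n) % n      ≡⟨ %-distribˡ-+ 1 m n ⟨
  (1 + m) % n              ∎
  where open ≡-Reasoning

module CycleGraph (k : ℕ) .{{_ : NonZero k}} where

  next : Fin k → Fin k
  next a = suc (toℕ a) mod k

  rotate : ℕ → Fin k → Fin k
  rotate zero    a = a
  rotate (suc j) a = next (rotate j a)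

  toℕ-next : ∀ a → toℕ (next a) ≡ suc (toℕ a) % k
  toℕ-next a = toℕ-fromℕ< _

  toℕ-rotate : ∀ j a → toℕ (rotate j a) ≡ (toℕ a + j) % k
  toℕ-rotate zero    a = sym (trans (cong (_% k) (+-identityʳ (toℕ a))) (m<n⇒m%n≡m (toℕ<n a)))
  toℕ-rotate (suc j) a = begin
    toℕ (next (rotate j a))     ≡⟨ toℕ-next (rotate j a) ⟩
    suc (toℕ (rotate j a)) % k  ≡⟨ cong (λ x → suc x % k) (toℕ-rotate j a) ⟩
    suc ((toℕ a + j) % k) % k   ≡⟨ [1+m%n]%n≡[1+m]%n (toℕ a + j) k ⟩
    suc (toℕ a + j) % k         ≡⟨ cong (_% k) (+-suc (toℕ a) j) ⟨
    (toℕ a + suc j) % k         ∎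
    where open ≡-Reasoning

  rotate-period : ∀ a → rotate k a ≡ a
  rotate-period a = toℕ-injective (begin
    toℕ (rotate k a)  ≡⟨ toℕ-rotate k a ⟩
    (toℕ a + k) % k   ≡⟨ [m+n]%n≡m%n (toℕ a) k ⟩
    toℕ a % k         ≡⟨ m<n⇒m%n≡m (toℕ<n a) ⟩
    toℕ a             ∎)
    where open ≡-Reasoning

  rotate-aperiodic : ∀ j a → 0 < j → j < k → rotate j a ≢ a
  rotate-aperiodic j a 0<j j<k rotate≡a = >⇒∤ {{>-nonZero 0<j}} j<k (divides q j≡q*k)
    where
    open ≡-Reasoning
    x = toℕ a
    q = (x + j) / k
    j≡q*k : j ≡ q * k
    j≡q*k = +-cancelˡ-≡ x j (q * k) (begin
      x + j               ≡⟨ m≡m%n+[m/n]*n (x + j) k ⟩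
      (x + j) % k + q * k ≡⟨ cong (_+ q * k) (trans (sym (toℕ-rotate j a)) (cong toℕ rotate≡a)) ⟩
      x + q * k           ∎)

  private
    succᵇ : ℕ → ℕ → Bool
    succᵇ i j = (suc i ≡ᵇ j) ∨ ((j ≡ᵇ 0) ∧ (suc i ≡ᵇ k))

  succᵇ⇒next : ∀ a b → succᵇ (toℕ a) (toℕ b) ≡ true → b ≡ next a
  succᵇ⇒next a b s = toℕ-injective (trans (toℕ-succ (∨-≡-true s)) (sym (toℕ-next a)))
    where
    open ≡-Reasoning
    toℕ-succ : (suc (toℕ a) ≡ᵇ toℕ b) ≡ true ⊎ ((toℕ b ≡ᵇ 0) ∧ (suc (toℕ a) ≡ᵇ k)) ≡ true →
               toℕ b ≡ suc (toℕ a) % k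
    toℕ-succ (inj₁ e) = begin
      toℕ b            ≡⟨ 1+a≡b ⟨
      suc (toℕ a)      ≡⟨ m<n⇒m%n≡m (subst (_< k) (sym 1+a≡b) (toℕ<n b)) ⟨
      suc (toℕ a) % k  ∎
      where 1+a≡b = ≡ᵇ-true⇒≡ e
    toℕ-succ (inj₂ e) with ∧-≡-true e
    ... | b≡0 , 1+a≡k = begin
      toℕ b            ≡⟨ ≡ᵇ-true⇒≡ b≡0 ⟩
      0                ≡⟨ n%n≡0 k ⟨
      k % k            ≡⟨ cong (_% k) (≡ᵇ-true⇒≡ 1+a≡k) ⟨
      suc (toℕ a) % k  ∎

  next⇒succᵇ : ∀ a → succᵇ (toℕ a) (toℕ (next a)) ≡ true
  next⇒succᵇ a with m≤n⇒m<n∨m≡n (toℕ<n a)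
  ... | inj₁ 1+a<k = ∨-≡-true⁻ (inj₁ (≡⇒≡ᵇ-true (sym (trans (toℕ-next a) (m<n⇒m%n≡m 1+a<k)))))
  ... | inj₂ 1+a≡k = ∨-≡-true⁻ {suc (toℕ a) ≡ᵇ toℕ (next a)}
    (inj₂ (∧-≡-true⁻ (≡⇒≡ᵇ-true next≡0) (≡⇒≡ᵇ-true 1+a≡k)))
    where
    next≡0 : toℕ (next a) ≡ 0
    next≡0 = trans (toℕ-next a) (trans (cong (_% k) 1+a≡k) (n%n≡0 k))

  cycleAdj≡succᵇ : ∀ a b → cycleAdj k a b ≡ succᵇ (toℕ a) (toℕ b) ∨ succᵇ (toℕ b) (toℕ a)
  cycleAdj≡succᵇ a b = ∨-shuffle (suc (toℕ a) ≡ᵇ toℕ b) (suc (toℕ b) ≡ᵇ toℕ a)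
    ((toℕ a ≡ᵇ 0) ∧ (suc (toℕ b) ≡ᵇ k)) ((toℕ b ≡ᵇ 0) ∧ (suc (toℕ a) ≡ᵇ k))

  cycle-adj⇒next : ∀ {a b} → Adj (Cycle k) a b → b ≡ next a ⊎ a ≡ next b
  cycle-adj⇒next {a} {b} e =
    Sum.map (succᵇ⇒next a b) (succᵇ⇒next b a) (∨-≡-true (trans (sym (cycleAdj≡succᵇ a b)) e))

  adj-next : ∀ a → Adj (Cycle k) a (next a)
  adj-next a = trans (cycleAdj≡succᵇ a (next a)) (∨-≡-true⁻ (inj₁ (next⇒succᵇ a)))

  next-adj : ∀ a → Adj (Cycle k) (next a) a
  next-adj a = trans (cycleAdj≡succᵇ (next a) a)
    (∨-≡-true⁻ {succᵇ (toℕ (next a)) (toℕ a)} (inj₂ (next⇒succᵇ a)))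

  cycle-symmetric : IsSymmetric (Cycle k)
  cycle-symmetric a b e with cycle-adj⇒next {a} {b} e
  ... | inj₁ refl = next-adj a
  ... | inj₂ refl = adj-next b

  next²≢ : 3 ≤ k → ∀ a → a ≢ next (next a)
  next²≢ 3≤k a a≡next² = rotate-aperiodic 2 a (s≤s z≤n) 3≤k (sym a≡next²)

  ¬adj-next² : 4 ≤ k → ∀ a → ¬ Adj (Cycle k) a (next (next a))
  ¬adj-next² 4≤k a e with cycle-adj⇒next {a} e
  ... | inj₁ next²≡next = rotate-aperiodic 1 (next a) (s≤s z≤n) (≤-trans (s≤s (s≤s z≤n)) 4≤k) next²≡next
  ... | inj₂ a≡next³    = rotate-aperiodic 3 a (s≤s z≤n) 4≤k (sym a≡next³)

  cyclicOrientation : 3 ≤ k → Orientation (Cycle k)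
  cyclicOrientation 3≤k = record
    { arc      = λ a b → ⌊ b ≟ next a ⌋
    ; arc-edge = λ a b ab → subst (Adj (Cycle k) a) (sym (⌊≟⌋⇒≡ ab)) (adj-next a)
    ; edge-dir = dir
    }
    where
    dir : ∀ a b → Adj (Cycle k) a b →
          (⌊ b ≟ next a ⌋ ≡ true × ⌊ a ≟ next b ⌋ ≡ false) ⊎ (⌊ b ≟ next a ⌋ ≡ false × ⌊ a ≟ next b ⌋ ≡ true)
    dir a b e with cycle-adj⇒next {a} {b} e
    ... | inj₁ refl = inj₁ (≡⇒⌊≟⌋ refl , ≢⇒⌊≟⌋ (next²≢ 3≤k a))
    ... | inj₂ refl = inj₂ (≢⇒⌊≟⌋ (next²≢ 3≤k b) , ≡⇒⌊≟⌋ refl)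

  cyclicOrientation-onePerfect : (3≤k : 3 ≤ k) → IsOnePerfect (Cycle k) (cyclicOrientation 3≤k)
  cyclicOrientation-onePerfect _ _ _ _ xy xz y≢z = contradiction (trans (⌊≟⌋⇒≡ xy) (sym (⌊≟⌋⇒≡ xz))) y≢z

  -- Every vertex of a cycle of length at least four has out-degree at most one, so an arc
  -- next a → a forces next² a → next a; going once around the cycle from a sink t then
  -- produces the arc t → rotate (k - 1) t.
  cycle-noSink : 4 ≤ k → (D : Orientation (Cycle k)) → IsOnePerfect (Cycle k) D → ∀ t → ¬ IsSink D t
  cycle-noSink 4≤k D P t sink-t = sink-t (rotate (pred k) t) (subst (λ x → Arc D x (rotate (pred k) t)) around (backward (pred k)))
    where
    Backward : Fin k → Set
    Backward a = Arc D (next a) a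
    backward-next : ∀ {a} → Backward a → Backward (next a)
    backward-next {a} back = reverseArc D (adj-next (next a))
      λ fwd → ¬adj-next² 4≤k a (P (next a) a (next (next a)) back fwd (next²≢ (≤-trans (n≤1+n 3) 4≤k) a))
    backward : ∀ j → Backward (rotate j t)
    backward zero    = reverseArc D (adj-next t) (sink-t (next t))
    backward (suc j) = backward-next (backward j)
    around : next (rotate (pred k) t) ≡ t
    around = trans (cong (λ j → rotate j t) (suc-pred k)) (rotate-period t)

-- Hollowed 2-trees

hollowed-symmetric : ∀ {G} → IsHollowedTwoTree G → IsSymmetric G
hollowed-symmetric (base zero ())
hollowed-symmetric (base (suc k) _)     = CycleGraph.cycle-symmetric (suc k)
hollowed-symmetric (step {G} T u v _)   = extend-symmetric {G} u v (hollowed-symmetric T)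
hollowed-symmetric (iso T I)            = ↪-symmetric (≅⇒↪⁻ I) (hollowed-symmetric T)

hollowed-onePerfectlyOrientable : (G : Graph) → IsHollowedTwoTree G → OnePerfectlyOrientable G
hollowed-onePerfectlyOrientable _ (base zero ())
hollowed-onePerfectlyOrientable _ (base (suc k) 4≤k) =
  cyclicOrientation 3≤k , cyclicOrientation-onePerfect 3≤k
  where
  open CycleGraph (suc k)
  3≤k = ≤-trans (n≤1+n 3) 4≤k
hollowed-onePerfectlyOrientable _ (step {G} T u v uv) with hollowed-onePerfectlyOrientable G T
... | D , P = extendOrientation D (λ _ → false) , extend-source-onePerfect (hollowed-symmetric T) uv P
  where open Extension G u v
hollowed-onePerfectlyOrientable _ (iso {G} T I) with hollowed-onePerfectlyOrientable G T
... | D , P = pullback (≅⇒↪⁻ I) D , pullback-onePerfect (≅⇒↪⁻ I) D P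

hollowed-noSink : (G : Graph) → IsHollowedTwoTree G → (D : Orientation G) →
  IsOnePerfect G D → (v : Fin (n G)) → ¬ IsSink D v
hollowed-noSink _ (base zero ())
hollowed-noSink _ (base (suc k) 4≤k) = CycleGraph.cycle-noSink (suc k) 4≤k
hollowed-noSink _ (step {G} T u v _) D P (suc t) sink-t =
  hollowed-noSink G T (restrict D) (pullback-onePerfect (extend-↪ u v) D P) t
    (pullback-sink (extend-↪ u v) D t sink-t)
  where open Extension G u v
hollowed-noSink _ (step {G} T u v uv) D P zero sink-new
  with Extension.newSink⇒restrictedSink G u v D P sink-new uv
... | s , sink-s = hollowed-noSink G T (restrict D) (pullback-onePerfect (extend-↪ u v) D P) s sink-s
  where open Extension G u v
hollowed-noSink _ (iso {G} T I) D P t sink-t =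
  hollowed-noSink G T (pullback (≅⇒↪ I) D) (pullback-onePerfect (≅⇒↪ I) D P) (Inverse.from bij t)
    (pullback-sink (≅⇒↪ I) D _ (subst (IsSink D) (sym (Inverse.strictlyInverseˡ bij t)) sink-t))
  where open _≅_ I

lemma16 : ((G : Graph) → IsTwoTree G → (v : Fin (n G)) →
    Σ (Orientation G) (λ D → IsOnePerfect G D × IsSink D v))
    × ((G : Graph) → IsTwoTree G → OnePerfectlyOrientable G)
    × ((G : Graph) → IsHollowedTwoTree G → OnePerfectlyOrientable G)
    × ((G : Graph) → IsHollowedTwoTree G → (D : Orientation G) →
    IsOnePerfect G D → (v : Fin (n G)) → ¬ IsSink D v)
lemma16 =
    twoTree-sinkOrientation
  , (λ G T → Product.map id proj₁ (twoTree-sinkOrientation G T (twoTree-vertex T)))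
  , hollowed-onePerfectlyOrientable
  , hollowed-noSink
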